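{- For all positive integers $s$ and $t$, \[ A(s,t)\le tK(s,t)<tK'(s,t)<A(s+1,t+2). \]
   Context: Ackermann function: $A(1,t)=2t$, $A(s,1)=2$, $A(s,t)=A(s-1,A(s,t-1))$ for $s,t>1$. For positive integers $s,t$: $K(1,t)=2$, $K'(1,t)=5$; $K(s,1)=2^s$, $K'(s,1)=2^s+3$; and for $s,t>1$, $K(s,t)=K(s,t-1)\,K(s-1,K'(s,t-1))$ and $K'(s,t)=K'(s,t-1)\,K(s-1,K'(s,t-1))+K'(s-1,K'(s,t-1))$. -}

module Defs where

open import Data.Nat using (ℕ; zero; suc; _+_; _*_; _^_)
open import Data.Product using (_×_; _,_; proj₁; proj₂)

-- Arguments are the actual
-- values s, t; values at s = 0 or t = 0 are irrelevant (set to 0).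
A : ℕ → ℕ → ℕ
A zero t = 0
A (suc s) zero = 0
A 1 (suc t) = 2 * suc t
A (suc (suc s)) 1 = 2
A (suc (suc s)) (suc (suc t)) = A (suc s) (A (suc (suc s)) (suc t))

-- KK s t = (K(s,t), K'(s,t)) for positive s, t (dummy (0,0) otherwise).
KK : ℕ → ℕ → ℕ × ℕ
KK zero t = 0 , 0
KK (suc s) zero = 0 , 0
KK 1 (suc t) = 2 , 5
KK (suc (suc s)) 1 = 2 ^ suc (suc s) , 2 ^ suc (suc s) + 3
KK (suc (suc s)) (suc (suc t)) =
  let k  = proj₁ (KK (suc (suc s)) (suc t))
      k' = proj₂ (KK (suc (suc s)) (suc t))
  in k * proj₁ (KK (suc s) k') , k' * proj₁ (KK (suc s) k') + proj₂ (KK (suc s) k')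

K : ℕ → ℕ → ℕ
K s t = proj₁ (KK s t)

K′ : ℕ → ℕ → ℕ
K′ s t = proj₂ (KK s t)

-- A(s, ·) at least doubles its argument, and for s ≥ 2 one step of the recursion at least
-- doubles the value, whence (k + 1) A(s, y) ≤ A(s, y + k).  The recursions for A and K then
-- compare directly: A(s, t + 1) = A(s - 1, A(s, t)) ≤ A(s - 1, K'(s, t)) ≤ K(s - 1, K'(s, t))
-- ≤ K(s, t + 1), using K < K'.  For the upper bound put x = K'(s, t); then
-- K'(s, t + 1) ≤ 2 x K'(s - 1, x) < 2 A(s, x + 2) by induction on s, and
-- (2t + 2) A(s, x + 2) ≤ A(s, x + 2t + 3) ≤ A(s, A(s + 1, t + 2)) = A(s + 1, t + 3),
-- where x + 2t + 3 ≤ A(s + 1, t + 2) follows from the bound at t since x ≥ 7, or,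
-- for t = 1, from A(s + 1, 3) = A(s, 4) ≥ 2^s + 8.

module Submission where

open import Defs
open import Data.Nat using (ℕ; zero; suc; _+_; _*_; _^_; _∸_; _≤_; _<_; _<?_; s≤s; z≤n; >-nonZero)
open import Data.Nat.Properties
open import Data.Nat.Tactic.RingSolver using (solve)
open import Data.List using ([]; _∷_)
open import Data.Product using (_×_; _,_)
open import Relation.Binary.PropositionalEquality using (_≡_; refl; sym; cong)
open import Relation.Nullary.Decidable using (from-yes)

open ≤-Reasoning

-- Lemma names use the paper's indices; the Agda variables are offsets from them, so that
-- e.g. A (2 + s) is A(s, ·) with s ≥ 2.

n+n≡2*n : ∀ n → n + n ≡ 2 * n
n+n≡2*n n = cong (n +_) (sym (+-identityʳ n))

A[1,n]≡2*n : ∀ n → A 1 n ≡ 2 * n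
A[1,n]≡2*n zero    = refl
A[1,n]≡2*n (suc n) = refl

A[s,2]≡4 : ∀ s → A (suc s) 2 ≡ 4
A[s,2]≡4 zero    = refl
A[s,2]≡4 (suc s) = A[s,2]≡4 s

A-unfold : ∀ s {n} → 1 ≤ n → A (2 + s) (suc n) ≡ A (suc s) (A (2 + s) n)
A-unfold s {suc n} _ = refl

2*n≤A : ∀ s n → 1 ≤ n → 2 * n ≤ A (suc s) n
2*n≤A zero    (suc n)       _ = ≤-refl
2*n≤A (suc s) 1             _ = ≤-refl
2*n≤A (suc s) (suc (suc n)) _ = let ih = 2*n≤A (suc s) (suc n) (s≤s z≤n) in begin
  2 * (2 + n)           ≡⟨ solve (n ∷ []) ⟩
  2 + 2 * (1 + n)       ≤⟨ +-mono-≤ (≤-trans (*-monoʳ-≤ 2 (s≤s z≤n)) ih) ih ⟩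
  a + a                 ≡⟨ n+n≡2*n a ⟩
  2 * a                 ≤⟨ 2*n≤A s a (≤-trans (s≤s z≤n) ih) ⟩
  A (suc s) a           ∎
  where
  a = A (2 + s) (1 + n)

1≤A : ∀ s n → 1 ≤ n → 1 ≤ A (suc s) n
1≤A s n 1≤n = ≤-trans 1≤n (≤-trans (m≤m+n n (n + 0)) (2*n≤A s n 1≤n))

[1+k]*A≤A[+k] : ∀ s y k → 1 ≤ y → suc k * A (2 + s) y ≤ A (2 + s) (y + k)
[1+k]*A≤A[+k] s y zero 1≤y = begin
  1 * A (2 + s) y    ≡⟨ *-identityˡ _ ⟩
  A (2 + s) y        ≡⟨ cong (A (2 + s)) (+-identityʳ y) ⟨
  A (2 + s) (y + 0)  ∎
[1+k]*A≤A[+k] s y (suc k) 1≤y = begin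
  a + suc k * a            ≤⟨ +-mono-≤ (≤-trans (m≤m+n a (k * a)) ih) ih ⟩
  b + b                    ≡⟨ n+n≡2*n b ⟩
  2 * b                    ≤⟨ 2*n≤A s b (1≤A (suc s) (y + k) 1≤y+k) ⟩
  A (suc s) b              ≡⟨ A-unfold s 1≤y+k ⟨
  A (2 + s) (suc (y + k))  ≡⟨ cong (A (2 + s)) (+-suc y k) ⟨
  A (2 + s) (y + suc k)    ∎
  where
  a = A (2 + s) y
  b = A (2 + s) (y + k)
  1≤y+k = ≤-trans 1≤y (m≤m+n y k)
  ih : suc k * a ≤ b
  ih = [1+k]*A≤A[+k] s y k 1≤y

A-monoʳ-≤ : ∀ s {y z} → 1 ≤ y → y ≤ z → A (2 + s) y ≤ A (2 + s) z
A-monoʳ-≤ s {y} {z} 1≤y y≤z = begin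
  A (2 + s) y                   ≤⟨ m≤n*m _ (suc (z ∸ y)) ⟩
  suc (z ∸ y) * A (2 + s) y     ≤⟨ [1+k]*A≤A[+k] s y (z ∸ y) 1≤y ⟩
  A (2 + s) (y + (z ∸ y))       ≡⟨ cong (A (2 + s)) (m+[n∸m]≡n y≤z) ⟩
  A (2 + s) z                   ∎

t*5<A[2,t+2] : ∀ t → 1 ≤ t → t * 5 < A 2 (2 + t)
t*5<A[2,t+2] 1             _ = from-yes (5 <? 8)
t*5<A[2,t+2] (suc (suc t)) _ = begin-strict
  5 + b         ≤⟨ +-monoˡ-≤ b (m≤m+n 5 (t * 5)) ⟩
  b + b         ≡⟨ n+n≡2*n b ⟩
  2 * b         <⟨ *-monoʳ-< 2 (t*5<A[2,t+2] (suc t) (s≤s z≤n)) ⟩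
  2 * a         ≡⟨ A[1,n]≡2*n a ⟨
  A 1 a         ∎
  where
  a = A 2 (3 + t)
  b = suc t * 5

2^s+8≤A[s+1,3] : ∀ s → 2 ^ (2 + s) + 8 ≤ A (3 + s) 3
2^s+8≤A[s+1,3] zero    = from-yes (12 ≤? 16)
2^s+8≤A[s+1,3] (suc s) = begin
  2 * p + 8              ≤⟨ +-monoʳ-≤ (2 * p) (m≤m+n 8 8) ⟩
  2 * p + 16             ≡⟨ *-distribˡ-+ 2 p 8 ⟨
  2 * (p + 8)            ≤⟨ *-monoʳ-≤ 2 (2^s+8≤A[s+1,3] s) ⟩
  2 * a                  ≤⟨ 2*n≤A (suc s) a (1≤A (2 + s) 3 (s≤s z≤n)) ⟩
  A (2 + s) a            ≡⟨ cong (A (3 + s)) (A[s,2]≡4 (3 + s)) ⟨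
  A (4 + s) 3            ∎
  where
  p = 2 ^ (2 + s)
  a = A (3 + s) 3

K[1,n]≡2 : ∀ n → 1 ≤ n → K 1 n ≡ 2
K[1,n]≡2 (suc n) _ = refl

1≤K′ : ∀ s t → 1 ≤ t → 1 ≤ K′ (suc s) t
1≤K′ zero    (suc t)       _ = s≤s z≤n
1≤K′ (suc s) 1             _ = m≤n⇒m≤o+n (2 ^ (2 + s)) (s≤s z≤n)
1≤K′ (suc s) (suc (suc t)) _ = ≤-trans (1≤K′ s x (1≤K′ (suc s) (suc t) (s≤s z≤n))) (m≤n+m _ _)
  where x = K′ (2 + s) (suc t)

1≤K : ∀ s t → 1 ≤ t → 1 ≤ K (suc s) t
1≤K zero    (suc t)       _ = s≤s z≤n
1≤K (suc s) 1             _ = m^n>0 2 (2 + s)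
1≤K (suc s) (suc (suc t)) _ =
  *-mono-≤ (1≤K (suc s) (suc t) (s≤s z≤n)) (1≤K s x (1≤K′ (suc s) (suc t) (s≤s z≤n)))
  where x = K′ (2 + s) (suc t)

K<K′ : ∀ s t → 1 ≤ t → K (suc s) t < K′ (suc s) t
K<K′ zero    (suc t)       _ = from-yes (2 <? 5)
K<K′ (suc s) 1             _ = m<m+n (2 ^ (2 + s)) (s≤s z≤n)
K<K′ (suc s) (suc (suc t)) _ = begin-strict
  K (2 + s) (suc t) * c ≤⟨ *-monoˡ-≤ c (<⇒≤ (K<K′ (suc s) (suc t) (s≤s z≤n))) ⟩
  x * c                 <⟨ m<m+n (x * c) (1≤K′ s x (1≤K′ (suc s) (suc t) (s≤s z≤n))) ⟩
  x * c + K′ (suc s) x  ∎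
  where
  x = K′ (2 + s) (suc t)
  c = K (suc s) x

7≤K′ : ∀ s t → 1 ≤ t → 7 ≤ K′ (2 + s) t
7≤K′ s 1 _ = +-monoˡ-≤ 3 (^-monoʳ-≤ 2 {2} {2 + s} (s≤s (s≤s z≤n)))
7≤K′ s (suc (suc t)) _ = begin
  7              ≤⟨ 7≤K′ s (suc t) (s≤s z≤n) ⟩
  x              ≤⟨ m≤m*n x c {{>-nonZero (1≤K s x (1≤K′ (suc s) (suc t) (s≤s z≤n)))}} ⟩
  x * c          ≤⟨ m≤m+n (x * c) _ ⟩
  x * c + K′ (suc s) x  ∎
  where
  x = K′ (2 + s) (suc t)
  c = K (suc s) x

K′-suc≤2*K′*K′ : ∀ s t → 1 ≤ t → K′ (2 + s) (suc t) ≤ 2 * (K′ (2 + s) t * K′ (suc s) (K′ (2 + s) t))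
K′-suc≤2*K′*K′ s (suc t) _ = begin
  x * K (suc s) x + c′ ≤⟨ +-monoˡ-≤ c′ (*-monoʳ-≤ x (<⇒≤ (K<K′ s x 1≤x))) ⟩
  x * c′ + c′          ≤⟨ +-monoʳ-≤ (x * c′) (m≤n*m c′ x {{>-nonZero 1≤x}}) ⟩
  x * c′ + x * c′      ≡⟨ n+n≡2*n (x * c′) ⟩
  2 * (x * c′)         ∎
  where
  x = K′ (2 + s) (suc t)
  c′ = K′ (suc s) x
  1≤x = 1≤K′ (suc s) (suc t) (s≤s z≤n)

A≤K : ∀ s t → 1 ≤ t → A (2 + s) t ≤ K (2 + s) t
A≤K s 1 _ = *-monoʳ-≤ 2 (m^n>0 2 (1 + s))
A≤K zero (suc (suc t)) _ = begin
  A 1 (A 2 (suc t))  ≡⟨ A[1,n]≡2*n (A 2 (suc t)) ⟩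
  2 * A 2 (suc t)    ≤⟨ *-monoʳ-≤ 2 (A≤K zero (suc t) (s≤s z≤n)) ⟩
  2 * k              ≡⟨ *-comm 2 k ⟩
  k * 2              ≡⟨ cong (k *_) (K[1,n]≡2 x (1≤K′ 1 (suc t) (s≤s z≤n))) ⟨
  k * K 1 x          ∎
  where
  k = K 2 (suc t)
  x = K′ 2 (suc t)
A≤K (suc s) (suc (suc t)) _ = begin
  A (2 + s) a                   ≤⟨ A-monoʳ-≤ s 1≤a (≤-trans (A≤K (suc s) (suc t) (s≤s z≤n)) (<⇒≤ k<x)) ⟩
  A (2 + s) x                   ≤⟨ A≤K s x (1≤K′ (2 + s) (suc t) (s≤s z≤n)) ⟩
  K (2 + s) x                   ≤⟨ m≤n*m _ k {{>-nonZero (1≤K (2 + s) (suc t) (s≤s z≤n))}} ⟩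
  k * K (2 + s) x               ∎
  where
  k = K (3 + s) (suc t)
  x = K′ (3 + s) (suc t)
  a = A (3 + s) (suc t)
  1≤a = 1≤A (2 + s) (suc t) (s≤s z≤n)
  k<x = K<K′ (2 + s) (suc t) (s≤s z≤n)

A≤t*K : ∀ s t → 1 ≤ t → A (suc s) t ≤ t * K (suc s) t
A≤t*K zero    (suc t) _   = ≤-reflexive (*-comm 2 (suc t))
A≤t*K (suc s) t       1≤t = ≤-trans (A≤K s t 1≤t) (m≤n*m _ t {{>-nonZero 1≤t}})

x+2t+3≤1+t*x : ∀ t x → 6 ≤ x → x + (2 * (2 + t) + 3) ≤ suc ((2 + t) * x)
x+2t+3≤1+t*x t x 6≤x = begin
  x + (2 * (2 + t) + 3)   ≡⟨ solve (x ∷ t ∷ []) ⟩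
  suc (x + (6 + t * 2))   ≤⟨ s≤s (+-monoʳ-≤ x (+-mono-≤ 6≤x (*-monoʳ-≤ t (≤-trans (m≤m+n 2 4) 6≤x)))) ⟩
  suc (x + (x + t * x))   ∎

K′+2t+3≤A[s+1,t+2] : ∀ s t → 1 ≤ t → t * K′ (2 + s) t < A (3 + s) (2 + t) →
                     K′ (2 + s) t + (2 * t + 3) ≤ A (3 + s) (2 + t)
K′+2t+3≤A[s+1,t+2] s 1 _ _ = begin
  2 ^ (2 + s) + 3 + 5  ≡⟨ +-assoc (2 ^ (2 + s)) 3 5 ⟩
  2 ^ (2 + s) + 8      ≤⟨ 2^s+8≤A[s+1,3] s ⟩
  A (3 + s) 3          ∎
K′+2t+3≤A[s+1,t+2] s (suc (suc t)) _ t*x<A =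
  ≤-trans (x+2t+3≤1+t*x t x (<⇒≤ (7≤K′ s (2 + t) (s≤s z≤n)))) t*x<A
  where x = K′ (2 + s) (2 + t)

t*K′<A[s+1,t+2] : ∀ s t → 1 ≤ t → t * K′ (suc s) t < A (2 + s) (2 + t)
t*K′<A[s+1,t+2] zero    (suc t)       _ = t*5<A[2,t+2] (suc t) (s≤s z≤n)
t*K′<A[s+1,t+2] (suc s) 1             _ = begin-strict
  1 * (p + 3)    ≡⟨ *-identityˡ (p + 3) ⟩
  p + 3          <⟨ +-monoʳ-< p (from-yes (3 <? 8)) ⟩
  p + 8          ≤⟨ 2^s+8≤A[s+1,3] s ⟩
  A (3 + s) 3    ∎
  where p = 2 ^ (2 + s)
t*K′<A[s+1,t+2] (suc s) (suc (suc t)) _ = begin-strict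
  (2 + t) * K′ (2 + s) (2 + t)        ≤⟨ *-monoʳ-≤ (2 + t) (K′-suc≤2*K′*K′ s (suc t) (s≤s z≤n)) ⟩
  (2 + t) * (2 * (x * K′ (suc s) x))  <⟨ *-monoʳ-< (2 + t) (*-monoʳ-< 2 (t*K′<A[s+1,t+2] s x 1≤x)) ⟩
  (2 + t) * (2 * a)                   ≡⟨ regroup a ⟩
  suc (3 + 2 * t) * a                 ≤⟨ [1+k]*A≤A[+k] s (2 + x) (3 + 2 * t) (s≤s z≤n) ⟩
  A (2 + s) (2 + x + (3 + 2 * t))     ≡⟨ cong (A (2 + s)) (shift x) ⟩
  A (2 + s) (x + (2 * suc t + 3))     ≤⟨ A-monoʳ-≤ s (≤-trans 1≤x (m≤m+n x _))
                                           (K′+2t+3≤A[s+1,t+2] s (suc t) (s≤s z≤n)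
                                             (t*K′<A[s+1,t+2] (suc s) (suc t) (s≤s z≤n))) ⟩
  A (2 + s) (A (3 + s) (3 + t))       ∎
  where
  x = K′ (2 + s) (suc t)
  a = A (2 + s) (2 + x)
  1≤x = 1≤K′ (suc s) (suc t) (s≤s z≤n)
  regroup : ∀ a → (2 + t) * (2 * a) ≡ suc (3 + 2 * t) * a
  regroup a = solve (a ∷ t ∷ [])
  shift : ∀ x → 2 + x + (3 + 2 * t) ≡ x + (2 * suc t + 3)
  shift x = solve (x ∷ t ∷ [])

mainTheorem8 : (s t : ℕ) → 1 ≤ s → 1 ≤ t →
    (A s t ≤ t * K s t) × (t * K s t < t * K′ s t) × (t * K′ s t < A (s + 1) (t + 2))
mainTheorem8 (suc s) t _ 1≤t rewrite +-comm s 1 | +-comm t 2 =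
    A≤t*K s t 1≤t
  , *-monoʳ-< t {{>-nonZero 1≤t}} (K<K′ s t 1≤t)
  , t*K′<A[s+1,t+2] s t 1≤t
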